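{- Let $k\ge 0$ and let $n\ge 4$ be an integer with $3\cdot 2^k \le n \le 3\cdot 2^{k+1}$. Then the greedy graph $G_n$ of order $n$ satisfies \[ TCL(G_n)= n(k+2)-3\cdot 2^{k+1}. \]
   Context: A maximal outerplanar graph of order $n$ is regarded as a drawing consisting of an $n$-cycle $\mathcal{C}$ together with a triangulation (by non-crossing edges between vertices of $\mathcal{C}$) of the bounded region determined by $\mathcal{C}$. Edges not in $\mathcal{C}$ are chords; the length of a chord is the length of a shortest path in $\mathcal{C}$ between its endpoints; $TCL(G)$ is the sum of the lengths of all chords. The greedy graph $G_n$ ($n\ge 4$) is constructed as follows. Label the vertices of the $n$-cycle $\mathcal{C}$ as $v_1,\dots,v_n$ in clockwise order. (1) Add a shortest possible chord whose starting endpoint is $v_1$ and whose final endpoint lies after $v_1$ in the clockwise direction. (2) Take the final endpoint of the previously added chord as the starting endpoint of a new shortest possible chord whose final endpoint is positioned clockwise from its starting endpoint. (3) Continue adding chords in this way until $n-3$ chords have been added. Here "possible" means the new chord is drawn inside the bounded region, is not already an edge, and does not cross previously added chords; the result is a maximal outerplanar graph. -}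

module Defs where

open import Data.Nat using (ℕ; zero; suc; _+_; _*_; _∸_; _<ᵇ_; _≡ᵇ_; _⊓_)
open import Data.Nat.DivMod using (_%_)
open import Data.Bool using (Bool; true; false; _∧_; _∨_; not; if_then_else_)
open import Data.List using (List; []; _∷_; concatMap; _∷ʳ_; map)
open import Data.Nat.ListAction using (sum)
open import Data.Bool.ListAction using (any)
open import Data.Product using (_×_; _,_)
open import Data.Maybe using (Maybe; just; nothing)

-- Vertices of the n-cycle C are 0,1,…,n-1 (vertex v_i is i-1), in clockwise
-- order: the clockwise successor of i is (i+1) mod n.
-- A chord is an ordered pair (start , final) of vertices.
Chord : Set
Chord = ℕ × ℕ

cw : ℕ → ℕ → ℕ → ℕ
cw zero    a b = 0
cw (suc m) a b = (b + suc m ∸ a) % suc m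

chordLength : ℕ → Chord → ℕ
chordLength n (a , b) = cw n a b ⊓ (n ∸ cw n a b)

TCL : ℕ → List Chord → ℕ
TCL n cs = sum (map (chordLength n) cs)

strictlyBetween : ℕ → ℕ → ℕ → ℕ → Bool
strictlyBetween n a x b = (0 <ᵇ cw n a x) ∧ (cw n a x <ᵇ cw n a b)

-- two chords cross (in the convex drawing) iff they have four distinct
-- endpoints and exactly one endpoint of the second lies strictly inside
-- the clockwise arc between the endpoints of the first
distinct4 : ℕ → ℕ → ℕ → ℕ → Bool
distinct4 a b c d =
  not ((a ≡ᵇ c) ∨ (a ≡ᵇ d) ∨ (b ≡ᵇ c) ∨ (b ≡ᵇ d))

crosses : ℕ → Chord → Chord → Bool
crosses n (a , b) (c , d) =
  distinct4 a b c d ∧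
  not (strictlyBetween n a c b ≡ᵇᵇ strictlyBetween n a d b)
  where
  _≡ᵇᵇ_ : Bool → Bool → Bool
  true  ≡ᵇᵇ y = y
  false ≡ᵇᵇ y = not y

sameEdge : Chord → Chord → Bool
sameEdge (a , b) (c , d) = ((a ≡ᵇ c) ∧ (b ≡ᵇ d)) ∨ ((a ≡ᵇ d) ∧ (b ≡ᵇ c))

cwStep : ℕ → ℕ → ℕ → ℕ
cwStep zero    s d = 0
cwStep (suc m) s d = (s + d) % suc m

-- the chord from s going d steps clockwise is possible w.r.t. the chords cs:
-- it is not an edge of C (2 ≤ d ≤ n-2), it is not already a chord, and it
-- crosses no previously added chord
possible : ℕ → List Chord → ℕ → ℕ → Bool
possible n cs s d =
  (1 <ᵇ d) ∧ (d <ᵇ n ∸ 1) ∧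
  not (any (sameEdge (s , cwStep n s d)) cs) ∧
  not (any (crosses n (s , cwStep n s d)) cs)

-- offsets 2 ≤ ℓ … listed so that chord length is non-decreasing:
-- for ℓ = 2,3,…,n the offsets ℓ and n-ℓ (both give chord length ℓ when
-- ℓ ≤ n/2); ties are broken in favour of the smaller clockwise offset.
upFrom : ℕ → ℕ → List ℕ
upFrom a zero    = []
upFrom a (suc k) = a ∷ upFrom (suc a) k

candidateOffsets : ℕ → List ℕ
candidateOffsets n = concatMap (λ ℓ → ℓ ∷ (n ∸ ℓ) ∷ []) (upFrom 2 n)

firstPossible : ℕ → List Chord → ℕ → List ℕ → Maybe ℕ
firstPossible n cs s []       = nothing
firstPossible n cs s (d ∷ ds) =
  if possible n cs s d then just d else firstPossible n cs s ds

greedyRun : ℕ → ℕ → ℕ → List Chord → Maybe (List Chord)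
greedyRun n zero        s cs = just cs
greedyRun n (suc steps) s cs with firstPossible n cs s (candidateOffsets n)
... | nothing = nothing
... | just d  = greedyRun n steps (cwStep n s d) (cs ∷ʳ (s , cwStep n s d))

-- chords of the greedy graph G_n: n-3 chords, starting at v_1 (= 0);
-- `nothing` would signal that the procedure got stuck (it never does).
greedyChords : ℕ → Maybe (List Chord)
greedyChords n = greedyRun n (n ∸ 3) 0 []

{-# OPTIONS --safe #-}
-- The greedy procedure keeps the part of the disc that is not yet triangulated as a polygon,
-- described by its first corner s and the clockwise gaps g₀, g₁, …, h₁, h₂ between consecutive
-- corners. If g₀ + g₁ ≤ h₁ + h₂, every shorter chord from s is blocked by a side of that polygon
-- or by an earlier chord, so the greedy chord joins s to the corner g₀ + g₁ further on; it has
-- length g₀ + g₁, and the new polygon starts at its end with gaps …, h₁, h₂, g₀ + g₁. From n unit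
-- gaps the gap list always reads 2^J, …, 2^J, m, 2^(J+1), …, 2^(J+1) with 2^J ≤ m ≤ 2^(J+1), which
-- keeps the condition true. TCL(G_n) is therefore the total cost of n − 3 such merges. Give a gap
-- y of level J (2^J ≤ y ≤ 2^(J+1)) the weight (J+2)·y − 2^(J+1), the external path length of a
-- balanced binary tree with y leaves; merging two gaps of a common level adds exactly the cost
-- of the merge to the total weight. So TCL(G_n) is the weight (K+2)·n − 3·2^(K+1) of the three
-- final gaps of a common level K, and this value is the same for every K with
-- 3·2^K ≤ n ≤ 3·2^(K+1).
module Submission where

open import Defs
open import Data.Nat using (ℕ; _+_; _*_; _∸_; _^_; _≤_)
open import Data.List using (List)
open import Data.Maybe using (just)
open import Data.Product using (Σ; _×_)
open import Relation.Binary.PropositionalEquality using (_≡_)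

open import Data.Nat using (suc; zero; _<_; _<ᵇ_; _≡ᵇ_; s≤s; z≤n; _<?_; _≟_)
open import Data.Nat.Properties
open import Data.Nat.DivMod using (_%_; m%n<n; m%n%n≡m%n; [m+n]%n≡m%n; m<n⇒m%n≡m; %-distribˡ-+)
open import Data.Nat.ListAction using (sum)
open import Data.Nat.ListAction.Properties using (sum-++)
open import Data.Nat.Tactic.RingSolver using (solve-∀)
open import Data.Bool using (Bool; true; false; _∧_; not; T)
open import Data.Bool.Properties using (∧-zeroʳ; ∨-zeroʳ; ¬-not; T-≡; T-∨; T-∧)
open import Data.Bool.ListAction using (any)
open import Data.List using ([]; _∷_; _++_; _∷ʳ_; map; length; replicate; concatMap)
open import Data.List.Properties using (map-++; ++-assoc; length-++; length-replicate)
open import Data.List.Membership.Propositional using (_∈_)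
open import Data.List.Membership.Propositional.Properties using (∈-++⁺ˡ; ∈-++⁺ʳ; ∈-++⁻)
open import Data.List.Relation.Unary.Any using (here; there)
open import Data.List.Relation.Unary.All using (All; []; _∷_)
import Data.List.Relation.Unary.All as All
open import Data.List.Relation.Unary.All.Properties using (++⁺; ++⁻ʳ; ∷ʳ⁺; replicate⁺)
open import Data.Product using (_,_; proj₁; proj₂)
open import Data.Sum using (_⊎_; inj₁; inj₂)
import Data.Sum as Sum
open import Data.Empty using (⊥)
open import Function using (_∘_; Equivalence)
open import Relation.Nullary using (yes; no; contradiction)
open import Relation.Binary.Definitions using (tri<; tri≈; tri>)
open import Relation.Binary.PropositionalEquality
  using (refl; sym; trans; cong; cong₂; subst; subst₂; _≢_; module ≡-Reasoning)

open Equivalence using (to; from)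

-- Reflecting the boolean tests

<ᵇ-true : ∀ {m k} → m < k → (m <ᵇ k) ≡ true
<ᵇ-true m<k = to T-≡ (<⇒<ᵇ m<k)

<ᵇ-false : ∀ {m k} → k ≤ m → (m <ᵇ k) ≡ false
<ᵇ-false k≤m = ¬-not (λ eq → ≤⇒≯ k≤m (<ᵇ⇒< _ _ (from T-≡ eq)))

≡ᵇ-false : ∀ {m k} → m ≢ k → (m ≡ᵇ k) ≡ false
≡ᵇ-false m≢k = ¬-not (λ eq → m≢k (≡ᵇ⇒≡ _ _ (from T-≡ eq)))

any-true : ∀ {A : Set} (p : A → Bool) {x xs} → x ∈ xs → p x ≡ true → any p xs ≡ true
any-true p (here refl) px rewrite px = refl
any-true p (there {x = y} x∈xs) px rewrite any-true p x∈xs px = ∨-zeroʳ (p y)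

any-false : ∀ {A : Set} (p : A → Bool) xs → (∀ {x} → x ∈ xs → p x ≡ false) → any p xs ≡ false
any-false p []       _ = refl
any-false p (x ∷ xs) h rewrite h (here refl) = any-false p xs (h ∘ there)

sameEdge-refl : ∀ a b → sameEdge (a , b) (a , b) ≡ true
sameEdge-refl a b rewrite to T-≡ (≡⇒≡ᵇ a a refl) | to T-≡ (≡⇒≡ᵇ b b refl) = refl

sameEdge-swap : ∀ a b → sameEdge (a , b) (b , a) ≡ true
sameEdge-swap a b rewrite to T-≡ (≡⇒≡ᵇ a a refl) | to T-≡ (≡⇒≡ᵇ b b refl) = ∨-zeroʳ _

sameEdge-false : ∀ a b c d → (c , d) ≢ (a , b) → (c , d) ≢ (b , a) → sameEdge (a , b) (c , d) ≡ false
sameEdge-false a b c d ≢ab ≢ba = ¬-not (matches ∘ to T-∨ ∘ from T-≡)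
  where
  matches : T ((a ≡ᵇ c) ∧ (b ≡ᵇ d)) ⊎ T ((a ≡ᵇ d) ∧ (b ≡ᵇ c)) → ⊥
  matches (inj₁ t) with to T-∧ t
  ... | a≡c , b≡d = ≢ab (sym (cong₂ _,_ (≡ᵇ⇒≡ a c a≡c) (≡ᵇ⇒≡ b d b≡d)))
  matches (inj₂ t) with to T-∧ t
  ... | a≡d , b≡c = ≢ba (sym (cong₂ _,_ (≡ᵇ⇒≡ b c b≡c) (≡ᵇ⇒≡ a d a≡d)))

module _ (n : ℕ) where

  crosses-endpoint : ∀ s t a b → s ≡ a ⊎ s ≡ b ⊎ t ≡ a ⊎ t ≡ b → crosses n (s , t) (a , b) ≡ false
  crosses-endpoint s t a b shared
    rewrite to T-≡ (from T-∨ (Sum.map (≡⇒≡ᵇ s a) (from T-∨ ∘ Sum.map (≡⇒≡ᵇ s b)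
                     (from T-∨ ∘ Sum.map (≡⇒≡ᵇ t a) (≡⇒≡ᵇ t b))) shared)) = refl

  crosses-same-side : ∀ s t a b → strictlyBetween n s a t ≡ strictlyBetween n s b t →
                      crosses n (s , t) (a , b) ≡ false
  crosses-same-side s t a b same
    with strictlyBetween n s a t | strictlyBetween n s b t | same
  ... | true  | .true  | refl = ∧-zeroʳ _
  ... | false | .false | refl = ∧-zeroʳ _

  crosses-separating : ∀ s t a b → s ≢ a → s ≢ b → t ≢ a → t ≢ b →
                       strictlyBetween n s a t ≡ not (strictlyBetween n s b t) → crosses n (s , t) (a , b) ≡ true
  crosses-separating s t a b s≢a s≢b t≢a t≢b opposite
    rewrite ≡ᵇ-false s≢a | ≡ᵇ-false s≢b | ≡ᵇ-false t≢a | ≡ᵇ-false t≢b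
    with strictlyBetween n s a t | strictlyBetween n s b t | opposite
  ... | .false | true  | refl = refl
  ... | .true  | false | refl = refl

-- Merging gaps

sum-replicate : ∀ k x → sum (replicate k x) ≡ k * x
sum-replicate zero    x = refl
sum-replicate (suc k) x = cong (x +_) (sum-replicate k x)

-- g₀ + g₁ ≤ h₁ + h₂ is what makes the greedy chord span exactly the two leading gaps.
data Merges : ℕ → List ℕ → ℕ → Set where
  done  : ∀ {gs} → Merges 0 gs 0
  merge : ∀ {k c g₀ g₁ h₁ h₂} mid → g₀ + g₁ ≤ h₁ + h₂ →
          Merges k ((mid ++ h₁ ∷ h₂ ∷ []) ∷ʳ (g₀ + g₁)) c →
          Merges (suc k) (g₀ ∷ g₁ ∷ mid ++ h₁ ∷ h₂ ∷ []) (g₀ + g₁ + c)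

m≤n+n⇒m≤o+o⇒m≤n+o : ∀ {m n o} → m ≤ n + n → m ≤ o + o → m ≤ n + o
m≤n+n⇒m≤o+o⇒m≤n+o {n = n} {o} m≤2n m≤2o with ≤-total n o
... | inj₁ n≤o = ≤-trans m≤2n (+-monoʳ-≤ n n≤o)
... | inj₂ o≤n = ≤-trans m≤2o (+-monoˡ-≤ o o≤n)

last-two : ∀ (xs : List ℕ) → 2 ≤ length xs →
           Σ (List ℕ) λ mid → Σ ℕ λ h₁ → Σ ℕ λ h₂ → xs ≡ mid ++ h₁ ∷ h₂ ∷ []
last-two (x ∷ [])         (s≤s ())
last-two (x ∷ y ∷ [])     _ = [] , x , y , refl
last-two (x ∷ y ∷ z ∷ xs) _ with last-two (y ∷ z ∷ xs) (s≤s (s≤s z≤n))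
... | mid , h₁ , h₂ , eq = x ∷ mid , h₁ , h₂ , cong (x ∷_) eq

merge-balanced : ∀ {k c g₀ g₁ rest} → 2 ≤ length rest → All (λ y → g₀ + g₁ ≤ y + y) rest →
                 Merges k (rest ∷ʳ (g₀ + g₁)) c → Merges (suc k) (g₀ ∷ g₁ ∷ rest) (g₀ + g₁ + c)
merge-balanced {rest = rest} 2≤len balanced merges with last-two rest 2≤len
... | mid , h₁ , h₂ , refl with ++⁻ʳ mid balanced
...   | ≤2h₁ ∷ ≤2h₂ ∷ [] = merge mid (m≤n+n⇒m≤o+o⇒m≤n+o {n = h₁} {h₂} ≤2h₁ ≤2h₂) merges

sum-∷ʳ : ∀ xs x → sum (xs ∷ʳ x) ≡ x + sum xs
sum-∷ʳ xs x = trans (sum-++ xs (x ∷ [])) (trans (cong (sum xs +_) (+-identityʳ x)) (+-comm (sum xs) x))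

replicate-∷ʳ : ∀ {A : Set} k (x : A) → replicate k x ∷ʳ x ≡ x ∷ replicate k x
replicate-∷ʳ zero    x = refl
replicate-∷ʳ (suc k) x = cong (x ∷_) (replicate-∷ʳ k x)

sum-bounds : ∀ {a b} L → All (λ y → a ≤ y × y ≤ b) L → length L * a ≤ sum L × sum L ≤ length L * b
sum-bounds []      []                = z≤n , z≤n
sum-bounds (_ ∷ L) ((a≤y , y≤b) ∷ ys) =
  +-mono-≤ a≤y (proj₁ (sum-bounds L ys)) , +-mono-≤ y≤b (proj₂ (sum-bounds L ys))

sum-merge : ∀ g₀ g₁ rest → sum (rest ∷ʳ (g₀ + g₁)) ≡ sum (g₀ ∷ g₁ ∷ rest)
sum-merge g₀ g₁ rest = trans (sum-∷ʳ rest (g₀ + g₁)) (+-assoc g₀ g₁ (sum rest))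

n+n≡2*n : ∀ n → n + n ≡ 2 * n
n+n≡2*n n = cong (n +_) (sym (+-identityʳ n))

length-two-more : ∀ {b k} → suc (suc b) ≡ suc k + 3 → b ≡ k + 2
length-two-more {b} {k} len = suc-injective (trans (suc-injective len) (+-suc k 2))

layered : ℕ → ℕ → ℕ → ℕ → List ℕ
layered J α m β = replicate α (2 ^ J) ++ m ∷ replicate β (2 ^ suc J)

length-layered : ∀ J α m β → length (layered J α m β) ≡ α + suc β
length-layered J α m β = trans (length-++ (replicate α (2 ^ J)))
  (cong₂ _+_ (length-replicate α) (cong suc (length-replicate β)))

layered-within : ∀ J α m β → 2 ^ J ≤ m → m ≤ 2 ^ suc J →
                 All (λ y → 2 ^ J ≤ y × y ≤ 2 ^ suc J) (layered J α m β)
layered-within J α m β lo hi =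
  ++⁺ (replicate⁺ α (≤-refl , x≤2x)) ((lo , hi) ∷ replicate⁺ β (x≤2x , ≤-refl))
  where
  x≤2x : 2 ^ J ≤ 2 ^ suc J
  x≤2x = m≤m+n (2 ^ J) (2 ^ J + 0)

layered-∷ʳ : ∀ J α m β → layered J α m β ∷ʳ 2 ^ suc J ≡ layered J α m (suc β)
layered-∷ʳ J α m β = trans (++-assoc (replicate α (2 ^ J)) (m ∷ replicate β (2 ^ suc J)) _)
  (cong (λ r → replicate α (2 ^ J) ++ m ∷ r) (replicate-∷ʳ β (2 ^ suc J)))

record Merged (n k J : ℕ) (L : List ℕ) : Set where
  field
    cost level : ℕ
    merges     : Merges k L cost
    lower      : 3 * 2 ^ level ≤ n
    upper      : n ≤ 3 * 2 ^ suc level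
    -- the weights (J+2)·y − 2^(J+1) of the gaps telescope along the merges (written without ∸)
    potential  : cost + (J + 2) * n + 3 * 2 ^ suc level ≡ (level + 2) * n + (k + 3) * 2 ^ suc J

same-level-potential : ∀ x c P C F k → c + P + C ≡ F + (k + 3) * (2 * x) →
                       x + x + c + P + C ≡ F + (suc k + 3) * (2 * x)
same-level-potential x c P C F k ih = begin
  x + x + c + P + C                ≡⟨ regroup x c P C ⟩
  x + x + (c + P + C)              ≡⟨ cong (x + x +_) ih ⟩
  x + x + (F + (k + 3) * (2 * x))  ≡⟨ absorb x F k ⟩
  F + (suc k + 3) * (2 * x)        ∎
  where
  open ≡-Reasoning
  regroup : ∀ x c P C → x + x + c + P + C ≡ x + x + (c + P + C)
  regroup = solve-∀
  absorb : ∀ x F k → x + x + (F + (k + 3) * (2 * x)) ≡ F + (suc k + 3) * (2 * x)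
  absorb = solve-∀

level-up-potential : ∀ n e c C F J k y → e + (k + 2) * y ≡ n →
                     c + (suc J + 2) * n + C ≡ F + (k + 3) * (2 * y) →
                     e + c + (J + 2) * n + C ≡ F + (suc k + 3) * y
level-up-potential n e c C F J k y n≡ ih = +-cancelʳ-≡ n _ _ (begin
  e + c + (J + 2) * n + C + n              ≡⟨ regroup n e c C J ⟩
  e + (c + (suc J + 2) * n + C)            ≡⟨ cong (e +_) ih ⟩
  e + (F + (k + 3) * (2 * y))              ≡⟨ split e F k y ⟩
  F + (suc k + 3) * y + (e + (k + 2) * y)  ≡⟨ cong (F + (suc k + 3) * y +_) n≡ ⟩
  F + (suc k + 3) * y + n                  ∎)
  where
  open ≡-Reasoning
  regroup : ∀ n e c C J → e + c + (J + 2) * n + C + n ≡ e + (c + (suc J + 2) * n + C)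
  regroup = solve-∀
  split : ∀ e F k y → e + (F + (k + 3) * (2 * y)) ≡ F + (suc k + 3) * y + (e + (k + 2) * y)
  split = solve-∀

mutual
  layered-merges : ∀ {n} k J α m β → 2 ^ J ≤ m → m ≤ 2 ^ suc J → α + suc β ≡ k + 3 →
                   sum (layered J α m β) ≡ n → Merged n k J (layered J α m β)
  layered-merges zero J α m β lo hi len sum≡n = record
    { cost      = 0
    ; level     = J
    ; merges    = done
    ; lower     = subst (3 * 2 ^ J ≤_) sum≡n (proj₁ bounds)
    ; upper     = subst (_≤ 3 * 2 ^ suc J) sum≡n (proj₂ bounds)
    ; potential = refl
    }
    where
    L : List ℕ
    L = layered J α m β
    length≡3 : length L ≡ 3
    length≡3 = trans (length-layered J α m β) len
    bounds : 3 * 2 ^ J ≤ sum L × sum L ≤ 3 * 2 ^ suc J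
    bounds = subst (λ ℓ → ℓ * 2 ^ J ≤ sum L × sum L ≤ ℓ * 2 ^ suc J) length≡3
                   (sum-bounds L (layered-within J α m β lo hi))
  layered-merges {n} (suc k) J (suc (suc α)) m β lo hi len sum≡n = record
    { cost      = 2 ^ J + 2 ^ J + IH.cost
    ; level     = IH.level
    ; merges    = merge-balanced (subst (2 ≤_) (sym length-rest) (m≤n+m 2 k))
                    (All.map (λ bounds → +-mono-≤ (proj₁ bounds) (proj₁ bounds)) (layered-within J α m β lo hi))
                    (subst (λ L → Merges k L IH.cost) (sym merged) IH.merges)
    ; lower     = IH.lower
    ; upper     = IH.upper
    ; potential = same-level-potential (2 ^ J) IH.cost ((J + 2) * n) (3 * 2 ^ suc IH.level)
                    ((IH.level + 2) * n) k IH.potential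
    }
    where
    merged : layered J α m β ∷ʳ (2 ^ J + 2 ^ J) ≡ layered J α m (suc β)
    merged = trans (cong (layered J α m β ∷ʳ_) (n+n≡2*n (2 ^ J))) (layered-∷ʳ J α m β)
    length-rest : length (layered J α m β) ≡ k + 2
    length-rest = trans (length-layered J α m β) (length-two-more len)
    module IH = Merged (layered-merges k J α m (suc β) lo hi (trans (+-suc α (suc β)) (suc-injective len))
                          (trans (cong sum (sym merged)) (trans (sum-merge (2 ^ J) (2 ^ J) (layered J α m β)) sum≡n)))
  layered-merges (suc k) J 1 m β lo hi len sum≡n =
    level-up β (subst (_≤ 2 ^ J + m) (n+n≡2*n (2 ^ J)) (+-monoʳ-≤ (2 ^ J) lo))
               (+-mono-≤ (m≤m+n (2 ^ J) (2 ^ J + 0)) hi) (length-two-more len) sum≡n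
  layered-merges (suc k) J 0 m (suc β) lo hi len sum≡n =
    level-up β (m≤n+m (2 ^ suc J) m) (+-monoˡ-≤ (2 ^ suc J) hi) (length-two-more len) sum≡n
  layered-merges (suc k) J 0 m 0 _ _ len _ = contradiction (trans (suc-injective len) (+-comm k 3)) λ ()

  level-up : ∀ {n k J g₀ g₁} β → 2 ^ suc J ≤ g₀ + g₁ → g₀ + g₁ ≤ 2 ^ suc J + 2 ^ suc J → β ≡ k + 2 →
             sum (g₀ ∷ g₁ ∷ replicate β (2 ^ suc J)) ≡ n →
             Merged n (suc k) J (g₀ ∷ g₁ ∷ replicate β (2 ^ suc J))
  level-up {n} {k} {J} {g₀} {g₁} β lo hi β≡ sum≡n = record
    { cost      = g₀ + g₁ + IH.cost
    ; level     = IH.level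
    ; merges    = merge-balanced (subst (2 ≤_) (sym (trans (length-replicate β) β≡)) (m≤n+m 2 k))
                                 (replicate⁺ β hi) IH.merges
    ; lower     = IH.lower
    ; upper     = IH.upper
    ; potential = level-up-potential n (g₀ + g₁) IH.cost (3 * 2 ^ suc IH.level) ((IH.level + 2) * n)
                                     J k (2 ^ suc J) (begin
        g₀ + g₁ + (k + 2) * 2 ^ suc J          ≡⟨ cong (λ b → g₀ + g₁ + b * 2 ^ suc J) β≡ ⟨
        g₀ + g₁ + β * 2 ^ suc J                ≡⟨ cong (g₀ + g₁ +_) (sum-replicate β (2 ^ suc J)) ⟨
        g₀ + g₁ + sum (replicate β (2 ^ suc J)) ≡⟨ +-assoc g₀ g₁ _ ⟩
        sum (g₀ ∷ g₁ ∷ replicate β (2 ^ suc J)) ≡⟨ sum≡n ⟩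
        n                                      ∎) IH.potential
    }
    where
    open ≡-Reasoning
    module IH = Merged (layered-merges k (suc J) β (g₀ + g₁) 0 lo (subst (g₀ + g₁ ≤_) (n+n≡2*n (2 ^ suc J)) hi)
                          (trans (cong (_+ 1) β≡) (+-assoc k 2 1))
                          (trans (sum-merge g₀ g₁ (replicate β (2 ^ suc J))) sum≡n))

unit-gaps : ∀ N k → k + 3 ≡ suc N → Merged (suc N) k 0 (replicate (suc N) 1)
unit-gaps N k k+3≡n = subst (Merged (suc N) k 0) (replicate-∷ʳ N 1)
  (layered-merges k 0 N 1 0 ≤-refl (s≤s z≤n) (trans (+-comm N 1) (sym k+3≡n))
    (trans (cong sum (replicate-∷ʳ N 1)) (trans (sum-replicate (suc N) 1) (*-identityʳ (suc N)))))

level-zero-cost : ∀ {n k L} (merged : Merged n k 0 L) → k + 3 ≡ n →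
                  Merged.cost merged ≡ (Merged.level merged + 2) * n ∸ 3 * 2 ^ suc (Merged.level merged)
level-zero-cost {n} {k} merged k+3≡n = begin
  cost          ≡⟨ m+n∸n≡m cost C ⟨
  cost + C ∸ C  ≡⟨ cong (_∸ C) (+-cancelʳ-≡ (2 * n) (cost + C) F (begin
    cost + C + 2 * n    ≡⟨ +-assoc cost C (2 * n) ⟩
    cost + (C + 2 * n)  ≡⟨ cong (cost +_) (+-comm C (2 * n)) ⟩
    cost + (2 * n + C)  ≡⟨ +-assoc cost (2 * n) C ⟨
    cost + 2 * n + C    ≡⟨ potential ⟩
    F + (k + 3) * 2     ≡⟨ cong (λ m → F + m * 2) k+3≡n ⟩
    F + n * 2           ≡⟨ cong (F +_) (*-comm n 2) ⟩
    F + 2 * n           ∎)) ⟩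
  F ∸ C         ∎
  where
  open ≡-Reasoning
  open Merged merged
  C F : ℕ
  C = 3 * 2 ^ suc level
  F = (level + 2) * n

boundary-level-shift : ∀ {n} J → n ≡ 3 * 2 ^ suc J →
                       (J + 2) * n ∸ 3 * 2 ^ suc J ≡ (suc J + 2) * n ∸ 3 * 2 ^ suc (suc J)
boundary-level-shift {n} J n≡ = begin
  (J + 2) * n ∸ 3 * 2 ^ suc J            ≡⟨ cong₂ _∸_ (peel₁ J n) (sym n≡) ⟩
  (J + 1) * n + n ∸ n                    ≡⟨ m+n∸n≡m ((J + 1) * n) n ⟩
  (J + 1) * n                            ≡⟨ m+n∸n≡m ((J + 1) * n) (2 * n) ⟨
  (J + 1) * n + 2 * n ∸ 2 * n            ≡⟨ cong₂ _∸_ (peel₂ J n)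
                                                     (trans (cong (2 *_) n≡) (swap (2 ^ suc J))) ⟩
  (suc J + 2) * n ∸ 3 * 2 ^ suc (suc J)  ∎
  where
  open ≡-Reasoning
  peel₁ : ∀ J n → (J + 2) * n ≡ (J + 1) * n + n
  peel₁ = solve-∀
  peel₂ : ∀ J n → (J + 1) * n + 2 * n ≡ (suc J + 2) * n
  peel₂ = solve-∀
  swap : ∀ y → 2 * (3 * y) ≡ 3 * (2 * y)
  swap = solve-∀

adjacent-levels : ∀ {n} J K → J < K → 3 * 2 ^ K ≤ n → n ≤ 3 * 2 ^ suc J → K ≡ suc J × n ≡ 3 * 2 ^ suc J
adjacent-levels J K J<K lo hi with m≤n⇒m<n∨m≡n J<K
... | inj₁ 1+J<K = contradiction (≤-trans lo hi) (<⇒≱ (*-monoʳ-< 3 (^-monoʳ-< 2 (s≤s (s≤s z≤n)) 1+J<K)))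
... | inj₂ refl  = refl , ≤-antisym hi lo

level-formula-unique : ∀ {n} J K → 3 * 2 ^ J ≤ n → n ≤ 3 * 2 ^ suc J →
                       3 * 2 ^ K ≤ n → n ≤ 3 * 2 ^ suc K →
                       (J + 2) * n ∸ 3 * 2 ^ suc J ≡ (K + 2) * n ∸ 3 * 2 ^ suc K
level-formula-unique J K loJ hiJ loK hiK with <-cmp J K
... | tri≈ _ refl _ = refl
... | tri< J<K _ _ with adjacent-levels J K J<K loK hiJ
...   | refl , n≡ = boundary-level-shift J n≡
level-formula-unique J K loJ hiJ loK hiK | tri> _ _ K<J with adjacent-levels K J K<J loJ hiK
...   | refl , n≡ = sym (boundary-level-shift K n≡)

-- Chords of the n-cycle

module Cycle (N : ℕ) where

  n : ℕ
  n = suc N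

  %-absorbˡ : ∀ a b → (a % n + b) % n ≡ (a + b) % n
  %-absorbˡ a b = begin
    (a % n + b) % n          ≡⟨ %-distribˡ-+ (a % n) b n ⟩
    (a % n % n + b % n) % n  ≡⟨ cong (λ z → (z + b % n) % n) (m%n%n≡m%n a n) ⟩
    (a % n + b % n) % n      ≡⟨ %-distribˡ-+ a b n ⟨
    (a + b) % n              ∎
    where open ≡-Reasoning

  %-absorbʳ : ∀ a b → (a + b % n) % n ≡ (a + b) % n
  %-absorbʳ a b = trans (cong (_% n) (+-comm a (b % n)))
                        (trans (%-absorbˡ b a) (cong (_% n) (+-comm b a)))

  cwStep<n : ∀ v d → cwStep n v d < n
  cwStep<n v d = m%n<n (v + d) n

  cwStep-cwStep : ∀ v a b → cwStep n (cwStep n v a) b ≡ cwStep n v (a + b)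
  cwStep-cwStep v a b = trans (%-absorbˡ (v + a) b) (cong (_% n) (+-assoc v a b))

  cw-unique : ∀ {a v w} → a ≤ n → w < n → (w + a) % n ≡ v % n → cw n a v ≡ w
  cw-unique {a} {v} {w} a≤n w<n w+a≡v = begin
    (v + n ∸ a) % n              ≡⟨ cong (_% n) (+-∸-assoc v a≤n) ⟩
    (v + (n ∸ a)) % n            ≡⟨ %-absorbˡ v (n ∸ a) ⟨
    (v % n + (n ∸ a)) % n        ≡⟨ cong (λ z → (z + (n ∸ a)) % n) w+a≡v ⟨
    ((w + a) % n + (n ∸ a)) % n  ≡⟨ %-absorbˡ (w + a) (n ∸ a) ⟩
    (w + a + (n ∸ a)) % n        ≡⟨ cong (_% n) (+-assoc w a (n ∸ a)) ⟩
    (w + (a + (n ∸ a))) % n      ≡⟨ cong (λ z → (w + z) % n) (m+[n∸m]≡n a≤n) ⟩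
    (w + n) % n                  ≡⟨ [m+n]%n≡m%n w n ⟩
    w % n                        ≡⟨ m<n⇒m%n≡m w<n ⟩
    w                            ∎
    where open ≡-Reasoning

  cw<n : ∀ a v → cw n a v < n
  cw<n a v = m%n<n (v + n ∸ a) n

  wrap<n : ∀ {A B} → B < A → A < n → n + B ∸ A < n
  wrap<n {A} {B} B<A A<n = begin-strict
    n + B ∸ A  <⟨ ∸-monoˡ-< (+-monoʳ-< n B<A) (≤-trans (<⇒≤ A<n) (m≤m+n n B)) ⟩
    n + A ∸ A  ≡⟨ m+n∸n≡m n A ⟩
    n          ∎
    where open ≤-Reasoning

  between-cw0 : ∀ {a v b} → cw n a v ≡ 0 → strictlyBetween n a v b ≡ false
  between-cw0 cw≡0 rewrite cw≡0 = refl

  between-cw≥ : ∀ {a v b} → cw n a b ≤ cw n a v → strictlyBetween n a v b ≡ false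
  between-cw≥ cw≥ rewrite <ᵇ-false cw≥ = ∧-zeroʳ _

  possible-dup : ∀ {cs s d c} → c ∈ cs → sameEdge (s , cwStep n s d) c ≡ true → possible n cs s d ≡ false
  possible-dup {cs} {s} {d} c∈cs dup rewrite any-true (sameEdge (s , cwStep n s d)) c∈cs dup =
    trans (cong ((1 <ᵇ d) ∧_) (∧-zeroʳ _)) (∧-zeroʳ _)

  possible-cross : ∀ {cs s d c} → c ∈ cs → crosses n (s , cwStep n s d) c ≡ true → possible n cs s d ≡ false
  possible-cross {cs} {s} {d} c∈cs cross rewrite any-true (crosses n (s , cwStep n s d)) c∈cs cross =
    trans (cong ((1 <ᵇ d) ∧_) (trans (cong ((d <ᵇ N) ∧_) (∧-zeroʳ _)) (∧-zeroʳ _))) (∧-zeroʳ _)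

  possible-N : ∀ {cs s} → possible n cs s N ≡ false
  possible-N rewrite <ᵇ-false {N} {N} ≤-refl = ∧-zeroʳ _

  possible-true : ∀ {cs s d} → 1 < d → d < N →
                  (∀ {c} → c ∈ cs → sameEdge (s , cwStep n s d) c ≡ false ×
                                    crosses n (s , cwStep n s d) c ≡ false) →
                  possible n cs s d ≡ true
  possible-true {cs} {s} {d} 1<d d<N compatible
    rewrite <ᵇ-true 1<d | <ᵇ-true d<N
          | any-false (sameEdge (s , cwStep n s d)) cs (proj₁ ∘ compatible)
          | any-false (crosses n (s , cwStep n s d)) cs (proj₂ ∘ compatible) = refl

  firstPossible-candidates : ∀ {cs s D} a k → a ≤ D → D < a + k →
    (∀ ℓ → a ≤ ℓ → ℓ < D → possible n cs s ℓ ≡ false × possible n cs s (n ∸ ℓ) ≡ false) →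
    possible n cs s D ≡ true →
    firstPossible n cs s (concatMap (λ ℓ → ℓ ∷ (n ∸ ℓ) ∷ []) (upFrom a k)) ≡ just D
  firstPossible-candidates a zero a≤D D<a+0 _ _ =
    contradiction (subst (_ <_) (+-identityʳ a) D<a+0) (≤⇒≯ a≤D)
  firstPossible-candidates {D = D} a (suc k) a≤D D<a+k blocked D-ok with m≤n⇒m<n∨m≡n a≤D
  ... | inj₂ refl rewrite D-ok = refl
  ... | inj₁ a<D rewrite proj₁ (blocked a ≤-refl a<D) | proj₂ (blocked a ≤-refl a<D) =
    firstPossible-candidates (suc a) k a<D (subst (D <_) (+-suc a k) D<a+k)
      (λ ℓ a<ℓ → blocked ℓ (<⇒≤ a<ℓ)) D-ok

  -- Triangulated cs a b: the region between the chord ab and the clockwise arc from a to b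
  -- is triangulated by cs.
  data Triangulated (cs : List Chord) : ℕ → ℕ → Set where
    side  : ∀ {a b} → cw n a b ≡ 1 → Triangulated cs a b
    chord : ∀ {a b} q → q < n → (a , b) ∈ cs → strictlyBetween n a q b ≡ true →
            Triangulated cs a q → Triangulated cs q b → Triangulated cs a b

  Triangulated-++ : ∀ {cs a b} ds → Triangulated cs a b → Triangulated (cs ++ ds) a b
  Triangulated-++ ds (side cw≡1)                = side cw≡1
  Triangulated-++ ds (chord q q<n ab∈cs inside t₁ t₂) =
    chord q q<n (∈-++⁺ˡ ab∈cs) inside (Triangulated-++ ds t₁) (Triangulated-++ ds t₂)

  walk : ℕ → List ℕ → ℕ
  walk v []       = v
  walk v (g ∷ gs) = walk (cwStep n v g) gs

  corners : ℕ → List ℕ → List ℕ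
  corners v []       = []
  corners v (g ∷ gs) = v ∷ corners (cwStep n v g) gs

  sides : ℕ → List ℕ → List Chord
  sides v []       = []
  sides v (g ∷ gs) = (v , cwStep n v g) ∷ sides (cwStep n v g) gs

  corners-++ : ∀ v xs ys → corners v (xs ++ ys) ≡ corners v xs ++ corners (walk v xs) ys
  corners-++ v []       ys = refl
  corners-++ v (x ∷ xs) ys = cong (v ∷_) (corners-++ (cwStep n v x) xs ys)

  sides-++ : ∀ v xs ys → sides v (xs ++ ys) ≡ sides v xs ++ sides (walk v xs) ys
  sides-++ v []       ys = refl
  sides-++ v (x ∷ xs) ys = cong ((v , cwStep n v x) ∷_) (sides-++ (cwStep n v x) xs ys)

  first-corner : ∀ v xs y ys → v ∈ corners v (xs ++ y ∷ ys)
  first-corner v []      y ys = here refl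
  first-corner v (_ ∷ _) y ys = here refl

  -- pos d is the vertex d steps clockwise from s; arcs avoiding s become intervals of offsets,
  -- the last one ending at pos n = s.
  module Around (s : ℕ) (s<n : s < n) where

    pos : ℕ → ℕ
    pos = cwStep n s

    pos0 : pos 0 ≡ s
    pos0 = trans (cong (_% n) (+-identityʳ s)) (m<n⇒m%n≡m s<n)

    pos-+n : ∀ x → pos (n + x) ≡ pos x
    pos-+n x = trans (cong (_% n) (trans (cong (s +_) (+-comm n x)) (sym (+-assoc s x n))))
                     ([m+n]%n≡m%n (s + x) n)

    posN : pos n ≡ s
    posN = trans (cong pos (sym (+-identityʳ n))) (trans (pos-+n 0) pos0)

    cw-pos : ∀ {A B} → A ≤ B → B ∸ A < n → cw n (pos A) (pos B) ≡ B ∸ A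
    cw-pos {A} {B} A≤B B∸A<n = cw-unique (<⇒≤ (cwStep<n s A)) B∸A<n (begin
      (B ∸ A + (s + A) % n) % n  ≡⟨ %-absorbʳ (B ∸ A) (s + A) ⟩
      (B ∸ A + (s + A)) % n      ≡⟨ cong (_% n) (trans (+-comm (B ∸ A) (s + A))
                                     (trans (+-assoc s A (B ∸ A)) (cong (s +_) (m+[n∸m]≡n A≤B)))) ⟩
      (s + B) % n                ≡⟨ m%n%n≡m%n (s + B) n ⟨
      (s + B) % n % n            ∎)
      where open ≡-Reasoning

    cw-pos-wrap : ∀ {A B} → B < A → A < n → cw n (pos A) (pos B) ≡ n + B ∸ A
    cw-pos-wrap {A} {B} B<A A<n = trans (cong (cw n (pos A)) (sym (pos-+n B)))
      (cw-pos (≤-trans (<⇒≤ A<n) (m≤m+n n B)) (wrap<n B<A A<n))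

    off-pos : ∀ {d} → d < n → cw n s (pos d) ≡ d
    off-pos d<n = subst (λ v → cw n v (pos _) ≡ _) pos0 (cw-pos z≤n d<n)

    pos-off : ∀ {v} → v < n → pos (cw n s v) ≡ v
    pos-off {v} v<n = begin
      (s + (v + n ∸ s) % n) % n  ≡⟨ %-absorbʳ s (v + n ∸ s) ⟩
      (s + (v + n ∸ s)) % n      ≡⟨ cong (_% n) (m+[n∸m]≡n (≤-trans (<⇒≤ s<n) (m≤n+m n v))) ⟩
      (v + n) % n                ≡⟨ [m+n]%n≡m%n v n ⟩
      v % n                      ≡⟨ m<n⇒m%n≡m v<n ⟩
      v                          ∎
      where open ≡-Reasoning

    pos-injective : ∀ {A B} → A < n → B < n → pos A ≡ pos B → A ≡ B
    pos-injective A<n B<n eq = trans (sym (off-pos A<n)) (trans (cong (cw n s) eq) (off-pos B<n))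

    -- B ∸ A < n rules out the full turn from pos 0 to pos n, whose arc is empty.
    between-pos : ∀ {A x B} → A < x → x < B → B ∸ A < n →
                  strictlyBetween n (pos A) (pos x) (pos B) ≡ true
    between-pos {A} {x} {B} A<x x<B B∸A<n
      rewrite cw-pos (<⇒≤ A<x) (≤-<-trans (∸-monoˡ-≤ A (<⇒≤ x<B)) B∸A<n)
            | cw-pos (<⇒≤ (<-trans A<x x<B)) B∸A<n
            | <ᵇ-true (m<n⇒0<n∸m A<x) | <ᵇ-true (∸-monoˡ-< x<B (<⇒≤ A<x)) = refl

    not-between-pos : ∀ {A x B} → A < B → B ≤ n → B ∸ A < n → x < n → x ≤ A ⊎ B ≤ x →
                      strictlyBetween n (pos A) (pos x) (pos B) ≡ false
    not-between-pos {A} {x} {B} A<B B≤n B∸A<n x<n outside with outside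
    ... | inj₂ B≤x = between-cw≥ {pos A} {pos x} {pos B} (subst₂ _≤_ (sym cw-B)
            (sym (cw-pos (≤-trans (<⇒≤ A<B) B≤x) (≤-<-trans (m∸n≤m x A) x<n))) (∸-monoˡ-≤ A B≤x))
      where
      cw-B : cw n (pos A) (pos B) ≡ B ∸ A
      cw-B = cw-pos (<⇒≤ A<B) B∸A<n
    ... | inj₁ x≤A with m≤n⇒m<n∨m≡n x≤A
    ...   | inj₂ refl = between-cw0 {pos A} {pos x} {pos B}
                          (trans (cw-pos ≤-refl (≤-<-trans (m∸n≤m x x) x<n)) (n∸n≡0 x))
    ...   | inj₁ x<A = between-cw≥ {pos A} {pos x} {pos B} (subst₂ _≤_ (sym cw-B)
            (sym (cw-pos-wrap x<A (<-≤-trans A<B B≤n))) (∸-monoˡ-≤ A (≤-trans B≤n (m≤m+n n x))))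
      where
      cw-B : cw n (pos A) (pos B) ≡ B ∸ A
      cw-B = cw-pos (<⇒≤ A<B) B∸A<n

    between-pos⁻ : ∀ {A x B} → A < B → B ≤ n → B ∸ A < n → x < n →
                   strictlyBetween n (pos A) (pos x) (pos B) ≡ true → A < x × x < B
    between-pos⁻ {A} {x} {B} A<B B≤n B∸A<n x<n inside with A <? x | x <? B
    ... | yes A<x | yes x<B = A<x , x<B
    ... | no A≮x | _ = contradiction (trans (sym inside)
                         (not-between-pos A<B B≤n B∸A<n x<n (inj₁ (≮⇒≥ A≮x)))) λ ()
    ... | yes _ | no x≮B = contradiction (trans (sym inside)
                             (not-between-pos A<B B≤n B∸A<n x<n (inj₂ (≮⇒≥ x≮B)))) λ ()

    walk-pos : ∀ X gs → walk (pos X) gs ≡ pos (X + sum gs)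
    walk-pos X []       = cong pos (sym (+-identityʳ X))
    walk-pos X (g ∷ gs) = begin
      walk (cwStep n (pos X) g) gs  ≡⟨ cong (λ v → walk v gs) (cwStep-cwStep s X g) ⟩
      walk (pos (X + g)) gs         ≡⟨ walk-pos (X + g) gs ⟩
      pos (X + g + sum gs)          ≡⟨ cong pos (+-assoc X g (sum gs)) ⟩
      pos (X + (g + sum gs))        ∎
      where open ≡-Reasoning

    corners-between : ∀ {v} X gs → All (0 <_) gs → v ∈ corners (pos X) gs →
                      Σ ℕ λ Y → X ≤ Y × Y < X + sum gs × v ≡ pos Y
    corners-between X (g ∷ gs) (0<g ∷ _) (here refl) =
      X , ≤-refl , m<m+n X (≤-trans 0<g (m≤m+n g (sum gs))) , refl
    corners-between {v} X (g ∷ gs) (_ ∷ gs>0) (there v∈)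
      with corners-between (X + g) gs gs>0 (subst (λ w → v ∈ corners w gs) (cwStep-cwStep s X g) v∈)
    ... | Y , X+g≤Y , Y< , refl = Y , ≤-trans (m≤m+n X g) X+g≤Y , subst (Y <_) (+-assoc X g (sum gs)) Y< , refl

    between-base : ∀ {x B} → 0 < x → x < B → B < n → strictlyBetween n s (pos x) (pos B) ≡ true
    between-base {x} {B} 0<x x<B B<n =
      subst (λ a → strictlyBetween n a (pos x) (pos B) ≡ true) pos0 (between-pos 0<x x<B B<n)

    not-between-base : ∀ {x B} → 0 < B → B ≤ x → x < n → strictlyBetween n s (pos x) (pos B) ≡ false
    not-between-base {x} {B} 0<B B≤x x<n = subst (λ a → strictlyBetween n a (pos x) (pos B) ≡ false) pos0
      (not-between-pos 0<B (<⇒≤ B<n) B<n x<n (inj₂ B≤x))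
      where
      B<n : B < n
      B<n = ≤-<-trans B≤x x<n

    base-side : ∀ {x D} → 0 < x → x < n → 0 < D → D < n → strictlyBetween n s (pos x) (pos D) ≡ (x <ᵇ D)
    base-side {x} {D} 0<x x<n 0<D D<n with x <? D
    ... | yes x<D = trans (between-base 0<x x<D D<n) (sym (<ᵇ-true x<D))
    ... | no x≮D  = trans (not-between-base 0<D (≮⇒≥ x≮D) x<n) (sym (<ᵇ-false (≮⇒≥ x≮D)))

    base≢pos : ∀ {x} → 0 < x → x < n → s ≢ pos x
    base≢pos 0<x x<n s≡x = >⇒≢ 0<x (sym (pos-injective (≤-<-trans z≤n x<n) x<n (trans pos0 s≡x)))

    endpoint-blocks : ∀ {cs a b d} → Triangulated cs a b → a ≡ s → b ≡ pos d → d < n →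
                      possible n cs s d ≡ false
    endpoint-blocks {cs} (side cw≡1) refl refl d<n =
      subst (λ d → possible n cs s d ≡ false) (sym (trans (sym (off-pos d<n)) cw≡1)) refl
    endpoint-blocks {d = d} (chord _ _ ab∈cs _ _ _) refl refl d<n =
      possible-dup {s = s} {d} ab∈cs (sameEdge-refl s (pos d))

    endpoint-blocks′ : ∀ {cs a b d} → Triangulated cs a b → a ≡ pos d → b ≡ s → 0 < d → d < n →
                       possible n cs s d ≡ false
    endpoint-blocks′ {cs} {d = d} (side cw≡1) refl refl 0<d d<n =
      subst (λ d → possible n cs s d ≡ false) (sym d≡N) (possible-N {cs} {s})
      where
      n∸d≡1 : n ∸ d ≡ 1
      n∸d≡1 = trans (sym (cw-pos (<⇒≤ d<n) (∸-monoʳ-< {n} {d} {0} 0<d (<⇒≤ d<n))))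
                    (trans (cong (cw n (pos d)) posN) cw≡1)
      d≡N : d ≡ N
      d≡N = suc-injective (trans (cong (_+ d) (sym n∸d≡1)) (m∸n+n≡m (<⇒≤ d<n)))
    endpoint-blocks′ {d = d} (chord _ _ ab∈cs _ _ _) refl refl 0<d d<n =
      possible-dup {s = s} {d} ab∈cs (sameEdge-swap s (pos d))

    crossing-blocks : ∀ {cs A B d} → 0 < A → A < d → d < B → B < n → (pos A , pos B) ∈ cs →
                      possible n cs s d ≡ false
    crossing-blocks {A = A} {B} {d} 0<A A<d d<B B<n ab∈cs =
      possible-cross {s = s} {d} ab∈cs (crosses-separating n s (pos d) (pos A) (pos B)
      (base≢pos 0<A A<n) (base≢pos 0<B B<n)
      (λ eq → >⇒≢ A<d (pos-injective d<n A<n eq)) (λ eq → <⇒≢ d<B (pos-injective d<n B<n eq))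
      (trans (between-base 0<A A<d d<n) (cong not (sym (not-between-base 0<d (<⇒≤ d<B) B<n)))))
      where
      d<n : d < n
      d<n = <-trans d<B B<n
      A<n : A < n
      A<n = <-trans A<d d<n
      0<d : 0 < d
      0<d = <-trans 0<A A<d
      0<B : 0 < B
      0<B = <-trans 0<d d<B

    -- The chord from s to pos d either crosses a chord of the triangulation or is one of its edges.
    triangulated-blocks : ∀ {cs a b A B d} → Triangulated cs a b → a ≡ pos A → b ≡ pos B →
                          A < B → B ≤ n → B ∸ A < n → A < d → d < B → possible n cs s d ≡ false
    triangulated-blocks (side cw≡1) refl refl A<B B≤n B∸A<n A<d d<B =
      contradiction (trans (sym (cw-pos (<⇒≤ A<B) B∸A<n)) cw≡1)
                    (>⇒≢ (≤-trans (s≤s (m<n⇒0<n∸m A<d)) (∸-monoˡ-< d<B (<⇒≤ A<d))))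
    triangulated-blocks {A = A} {B} {d} (chord q q<n ab∈cs inside t₁ t₂) refl refl A<B B≤n B∸A<n A<d d<B
      with between-pos⁻ A<B B≤n B∸A<n (cw<n s q)
             (subst (λ v → strictlyBetween n (pos A) v (pos B) ≡ true) (sym (pos-off q<n)) inside)
    ... | A<Q , Q<B with <-cmp d (cw n s q)
    ... | tri< d<Q _ _ = triangulated-blocks t₁ refl (sym (pos-off q<n))
                           A<Q (<⇒≤ (cw<n s q)) (≤-<-trans (m∸n≤m _ A) (cw<n s q)) A<d d<Q
    ... | tri> _ _ Q<d = triangulated-blocks t₂ (sym (pos-off q<n)) refl
                           Q<B B≤n (≤-<-trans (∸-monoʳ-≤ B (<⇒≤ A<Q)) B∸A<n) Q<d d<B
    ... | tri≈ _ refl _ with A ≟ 0 | B ≟ n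
    ...   | yes refl | _        = endpoint-blocks t₁ pos0 (sym (pos-off q<n)) (cw<n s q)
    ...   | no _     | yes refl = endpoint-blocks′ t₂ (sym (pos-off q<n)) posN (≤-trans (s≤s z≤n) A<Q) (cw<n s q)
    ...   | no A≢0   | no B≢n   = crossing-blocks (n≢0⇒n>0 A≢0) A<Q Q<B (≤∧≢⇒< B≤n B≢n) ab∈cs

    new-chord-fresh : ∀ {a b g D Y} → 0 < g → g < D → D < Y → Y < n →
                      strictlyBetween n a (pos g) b ≡ false → strictlyBetween n a (pos Y) b ≡ false →
                      sameEdge (s , pos D) (a , b) ≡ false
    new-chord-fresh {a} {b} {g} {D} {Y} 0<g g<D D<Y Y<n g-out Y-out = sameEdge-false s (pos D) a b
      (λ { refl → contradiction (trans (sym g-out) (between-base 0<g g<D D<n)) λ () })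
      (λ { refl → contradiction (trans (sym Y-out)
                    (subst (λ b → strictlyBetween n (pos D) (pos Y) b ≡ true) posN
                           (between-pos D<Y Y<n (∸-monoʳ-< {n} {D} {0} 0<D (<⇒≤ D<n))))) λ () })
      where
      D<n : D < n
      D<n = <-trans D<Y Y<n
      0<D : 0 < D
      0<D = <-trans 0<g g<D

    -- Off the shared endpoints, s outside the arc ab forces A < B, and pos D outside it puts A and B
    -- on the same side of D.
    new-chord-uncrossed : ∀ {a b A B D} → a ≡ pos A → b ≡ pos B → A < n → B < n → 0 < D → D < n →
                          strictlyBetween n a s b ≡ false → strictlyBetween n a (pos D) b ≡ false →
                          crosses n (s , pos D) (a , b) ≡ false
    new-chord-uncrossed {A = A} {B} {D} refl refl A<n B<n 0<D D<n s-out D-out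
      with A ≟ 0 | B ≟ 0 | A ≟ D | B ≟ D
    ... | yes refl | _        | _        | _        =
      crosses-endpoint n s (pos D) (pos A) (pos B) (inj₁ (sym pos0))
    ... | no _     | yes refl | _        | _        =
      crosses-endpoint n s (pos D) (pos A) (pos B) (inj₂ (inj₁ (sym pos0)))
    ... | no _     | no _     | yes refl | _        =
      crosses-endpoint n s (pos D) (pos A) (pos B) (inj₂ (inj₂ (inj₁ refl)))
    ... | no _     | no _     | no _     | yes refl =
      crosses-endpoint n s (pos D) (pos A) (pos B) (inj₂ (inj₂ (inj₂ refl)))
    ... | no A≢0   | no B≢0   | no A≢D   | no B≢D   = crosses-same-side n s (pos D) (pos A) (pos B) (begin
      strictlyBetween n s (pos A) (pos D)  ≡⟨ base-side 0<A A<n 0<D D<n ⟩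
      A <ᵇ D                               ≡⟨ same-side ⟩
      B <ᵇ D                               ≡⟨ base-side 0<B B<n 0<D D<n ⟨
      strictlyBetween n s (pos B) (pos D)  ∎)
      where
      open ≡-Reasoning
      0<A : 0 < A
      0<A = n≢0⇒n>0 A≢0
      0<B : 0 < B
      0<B = n≢0⇒n>0 B≢0
      same-side : (A <ᵇ D) ≡ (B <ᵇ D)
      same-side with <-cmp A B
      ... | tri≈ _ refl _ = refl
      ... | tri> _ _ B<A = contradiction (trans (sym s-out)
              (subst₂ (λ v b → strictlyBetween n (pos A) v b ≡ true) posN (pos-+n B)
                      (between-pos A<n (m<m+n n 0<B) (wrap<n B<A A<n)))) λ ()
      ... | tri< A<B _ _ with <-cmp D A
      ...   | tri< D<A _ _ = trans (<ᵇ-false (<⇒≤ D<A)) (sym (<ᵇ-false (<⇒≤ (<-trans D<A A<B))))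
      ...   | tri≈ _ D≡A _ = contradiction (sym D≡A) A≢D
      ...   | tri> _ _ A<D with <-cmp D B
      ...     | tri< D<B _ _ = contradiction (trans (sym D-out)
                                 (between-pos A<D D<B (≤-<-trans (m∸n≤m B A) B<n))) λ ()
      ...     | tri≈ _ D≡B _ = contradiction (sym D≡B) B≢D
      ...     | tri> _ _ B<D = trans (<ᵇ-true (<-trans A<B B<D)) (sym (<ᵇ-true B<D))

  -- The polygon not yet triangulated, with corners s, s + g₀, s + g₀ + g₁, … taken clockwise.
  record OuterFace (s : ℕ) (cs : List Chord) (gs : List ℕ) : Set where
    field
      base<n             : s < n
      gaps-positive      : All (0 <_) gs
      gaps-sum           : sum gs ≡ n
      chords<n           : ∀ {a b} → (a , b) ∈ cs → a < n × b < n
      sides-triangulated : ∀ {a b} → (a , b) ∈ sides s gs → Triangulated cs a b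
      corners-outside    : ∀ {a b v} → (a , b) ∈ cs → v ∈ corners s gs → strictlyBetween n a v b ≡ false

  module Step {s cs g₀ g₁ h₁ h₂} (mid : List ℕ) (face : OuterFace s cs (g₀ ∷ g₁ ∷ mid ++ h₁ ∷ h₂ ∷ []))
              (D≤H : g₀ + g₁ ≤ h₁ + h₂) where
    open OuterFace face
    open Around s base<n

    rest : List ℕ
    rest = mid ++ h₁ ∷ h₂ ∷ []

    D X Y : ℕ
    D = g₀ + g₁
    X = D + sum mid
    Y = X + h₁

    0<g₀ : 0 < g₀
    0<g₀ = All.head gaps-positive

    0<g₁ : 0 < g₁
    0<g₁ = All.head (All.tail gaps-positive)

    rest>0 : All (0 <_) rest
    rest>0 = All.tail (All.tail gaps-positive)

    0<h₁ : 0 < h₁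
    0<h₁ = All.head (++⁻ʳ mid rest>0)

    0<h₂ : 0 < h₂
    0<h₂ = All.head (All.tail (++⁻ʳ mid rest>0))

    D+rest≡n : D + sum rest ≡ n
    D+rest≡n = trans (+-assoc g₀ g₁ (sum rest)) gaps-sum

    X+H≡n : X + (h₁ + h₂) ≡ n
    X+H≡n = begin
      D + sum mid + (h₁ + h₂)               ≡⟨ +-assoc D (sum mid) (h₁ + h₂) ⟩
      D + (sum mid + (h₁ + h₂))             ≡⟨ cong (λ h → D + (sum mid + (h₁ + h))) (+-identityʳ h₂) ⟨
      D + (sum mid + sum (h₁ ∷ h₂ ∷ []))    ≡⟨ cong (D +_) (sum-++ mid (h₁ ∷ h₂ ∷ [])) ⟨
      D + sum rest                          ≡⟨ D+rest≡n ⟩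
      n                                     ∎
      where open ≡-Reasoning

    g₀<D : g₀ < D
    g₀<D = m<m+n g₀ 0<g₁

    D≤X : D ≤ X
    D≤X = m≤m+n D (sum mid)

    X<Y : X < Y
    X<Y = m<m+n X 0<h₁

    Y<n : Y < n
    Y<n = subst (Y <_) (trans (+-assoc X h₁ h₂) X+H≡n) (m<m+n Y 0<h₂)

    0<D : 0 < D
    0<D = <-trans 0<g₀ g₀<D

    D<Y : D < Y
    D<Y = ≤-<-trans D≤X X<Y

    D<n : D < n
    D<n = <-trans D<Y Y<n

    next-base : cwStep n (pos g₀) g₁ ≡ pos D
    next-base = cwStep-cwStep s g₀ g₁

    old-side : ∀ {c} → c ∈ sides (pos D) rest → c ∈ sides s (g₀ ∷ g₁ ∷ rest)
    old-side {c} = there ∘ there ∘ subst (λ v → c ∈ sides v rest) (sym next-base)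

    old-corner : ∀ {v} → v ∈ corners (pos D) rest → v ∈ corners s (g₀ ∷ g₁ ∷ rest)
    old-corner {v} = there ∘ there ∘ subst (λ w → v ∈ corners w rest) (sym next-base)

    after-mid : ℕ
    after-mid = walk (pos D) mid

    after-mid≡X : after-mid ≡ pos X
    after-mid≡X = walk-pos D mid

    after-h₁≡Y : cwStep n after-mid h₁ ≡ pos Y
    after-h₁≡Y = trans (cong (λ v → cwStep n v h₁) after-mid≡X) (cwStep-cwStep s X h₁)

    after-h₂≡s : cwStep n (cwStep n after-mid h₁) h₂ ≡ s
    after-h₂≡s = trans (cong (λ v → cwStep n v h₂) after-h₁≡Y)
                      (trans (cwStep-cwStep s Y h₂) (trans (cong pos (trans (+-assoc X h₁ h₂) X+H≡n)) posN))

    last-sides : ∀ {c} → c ∈ sides after-mid (h₁ ∷ h₂ ∷ []) → c ∈ sides s (g₀ ∷ g₁ ∷ rest)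
    last-sides {c} = old-side ∘ subst (c ∈_) (sym (sides-++ (pos D) mid (h₁ ∷ h₂ ∷ []))) ∘ ∈-++⁺ʳ _

    side₀ : Triangulated cs s (pos g₀)
    side₀ = sides-triangulated (here refl)

    side₁ : Triangulated cs (pos g₀) (pos D)
    side₁ = subst (Triangulated cs (pos g₀)) next-base (sides-triangulated (there (here refl)))

    side₂ : Triangulated cs (pos X) (pos Y)
    side₂ = subst₂ (Triangulated cs) after-mid≡X after-h₁≡Y (sides-triangulated (last-sides (here refl)))

    side₃ : Triangulated cs (pos Y) s
    side₃ = subst₂ (Triangulated cs) after-h₁≡Y after-h₂≡s (sides-triangulated (last-sides (there (here refl))))

    corner-g₀ : pos g₀ ∈ corners s (g₀ ∷ g₁ ∷ rest)
    corner-g₀ = there (here refl)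

    corner-D : pos D ∈ corners s (g₀ ∷ g₁ ∷ rest)
    corner-D = old-corner (first-corner (pos D) mid h₁ (h₂ ∷ []))

    corner-Y : pos Y ∈ corners s (g₀ ∷ g₁ ∷ rest)
    corner-Y = old-corner (subst (pos Y ∈_) (sym (corners-++ (pos D) mid (h₁ ∷ h₂ ∷ [])))
                                 (∈-++⁺ʳ _ (there (here (sym after-h₁≡Y)))))

    short-blocked : ∀ {ℓ} → 0 < ℓ → ℓ < D → possible n cs s ℓ ≡ false
    short-blocked {ℓ} 0<ℓ ℓ<D with <-cmp ℓ g₀
    ... | tri< ℓ<g₀ _ _ = triangulated-blocks side₀ (sym pos0) refl 0<g₀ (<⇒≤ g₀<n) g₀<n 0<ℓ ℓ<g₀
      where
      g₀<n : g₀ < n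
      g₀<n = <-trans g₀<D D<n
    ... | tri≈ _ refl _ = endpoint-blocks side₀ refl refl (<-trans g₀<D D<n)
    ... | tri> _ _ g₀<ℓ =
      triangulated-blocks side₁ refl refl g₀<D (<⇒≤ D<n) (≤-<-trans (m∸n≤m D g₀) D<n) g₀<ℓ ℓ<D

    long<n : ∀ {ℓ} → 0 < ℓ → ℓ < D → n ∸ ℓ < n
    long<n 0<ℓ ℓ<D = ∸-monoʳ-< {n} {_} {0} 0<ℓ (<⇒≤ (<-trans ℓ<D D<n))

    X<long : ∀ {ℓ} → ℓ < D → X < n ∸ ℓ
    X<long {ℓ} ℓ<D = m+n≤o⇒m≤o∸n (suc X) (subst (X + ℓ <_) X+H≡n (+-monoʳ-< X (<-≤-trans ℓ<D D≤H)))

    long-blocked : ∀ {ℓ} → 0 < ℓ → ℓ < D → possible n cs s (n ∸ ℓ) ≡ false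
    long-blocked {ℓ} 0<ℓ ℓ<D with <-cmp (n ∸ ℓ) Y
    ... | tri< e<Y _ _ =
      triangulated-blocks side₂ refl refl X<Y (<⇒≤ Y<n) (≤-<-trans (m∸n≤m Y X) Y<n) (X<long ℓ<D) e<Y
    ... | tri≈ _ e≡Y _ = endpoint-blocks′ side₃ (cong pos (sym e≡Y)) refl
                           (≤-<-trans z≤n (X<long ℓ<D)) (long<n 0<ℓ ℓ<D)
    ... | tri> _ _ Y<e = triangulated-blocks side₃ refl (sym posN) Y<n ≤-refl
                           (∸-monoʳ-< {n} {Y} {0} (≤-<-trans z≤n (≤-<-trans D≤X X<Y)) (<⇒≤ Y<n)) Y<e (long<n 0<ℓ ℓ<D)

    D-compatible : ∀ {c} → c ∈ cs → sameEdge (s , pos D) c ≡ false × crosses n (s , pos D) c ≡ false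
    D-compatible {a , b} ab∈cs =
      new-chord-fresh 0<g₀ g₀<D D<Y Y<n (outside corner-g₀) (outside corner-Y) ,
      new-chord-uncrossed (sym (pos-off a<n)) (sym (pos-off b<n)) (cw<n s a) (cw<n s b) 0<D D<n
                          (outside (here refl)) (outside corner-D)
      where
      outside : ∀ {v} → v ∈ corners s (g₀ ∷ g₁ ∷ rest) → strictlyBetween n a v b ≡ false
      outside = corners-outside ab∈cs
      a<n : a < n
      a<n = proj₁ (chords<n ab∈cs)
      b<n : b < n
      b<n = proj₂ (chords<n ab∈cs)

    first-possible : firstPossible n cs s (candidateOffsets n) ≡ just D
    first-possible = firstPossible-candidates 2 n (+-mono-≤ 0<g₀ 0<g₁) (<-≤-trans D<n (m≤n+m n 2))
      (λ ℓ 2≤ℓ ℓ<D → short-blocked (≤-trans (s≤s z≤n) 2≤ℓ) ℓ<D ,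
                     long-blocked (≤-trans (s≤s z≤n) 2≤ℓ) ℓ<D)
      (possible-true {cs} {s} {D} (+-mono-≤ 0<g₀ 0<g₁) (<-≤-trans D<Y (≤-pred Y<n)) D-compatible)

    chord-length : chordLength n (s , pos D) ≡ D
    chord-length rewrite off-pos D<n =
      m≤n⇒m⊓n≡m (m+n≤o⇒m≤o∸n D (subst (D + D ≤_) X+H≡n (+-mono-≤ D≤X D≤H)))

    walk-rest : walk (pos D) rest ≡ s
    walk-rest = trans (walk-pos D rest) (trans (cong pos D+rest≡n) posN)

    next-sides : sides (pos D) (rest ∷ʳ D) ≡ sides (pos D) rest ∷ʳ (s , pos D)
    next-sides = trans (sides-++ (pos D) rest (D ∷ []))
                       (cong (λ v → sides (pos D) rest ++ (v , cwStep n v D) ∷ []) walk-rest)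

    next-corners : corners (pos D) (rest ∷ʳ D) ≡ corners (pos D) rest ∷ʳ s
    next-corners = trans (corners-++ (pos D) rest (D ∷ [])) (cong (λ v → corners (pos D) rest ++ v ∷ []) walk-rest)

    new-side : Triangulated (cs ∷ʳ (s , pos D)) s (pos D)
    new-side = chord (pos g₀) (cwStep<n s g₀) (∈-++⁺ʳ cs (here refl)) (between-base 0<g₀ g₀<D D<n)
                     (Triangulated-++ _ side₀) (Triangulated-++ _ side₁)

    next-face : OuterFace (pos D) (cs ∷ʳ (s , pos D)) (rest ∷ʳ D)
    next-face = record
      { base<n             = cwStep<n s D
      ; gaps-positive      = ∷ʳ⁺ rest>0 0<D
      ; gaps-sum           = trans (sum-++ rest (D ∷ []))
                               (trans (cong (sum rest +_) (+-identityʳ D)) (trans (+-comm (sum rest) D) D+rest≡n))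
      ; chords<n           = next-chords<n
      ; sides-triangulated = next-triangulated
      ; corners-outside    = next-outside
      }
      where
      next-chords<n : ∀ {a b} → (a , b) ∈ cs ∷ʳ (s , pos D) → a < n × b < n
      next-chords<n ab∈ with ∈-++⁻ cs ab∈
      ... | inj₁ old         = chords<n old
      ... | inj₂ (here refl) = base<n , cwStep<n s D

      next-triangulated : ∀ {a b} → (a , b) ∈ sides (pos D) (rest ∷ʳ D) → Triangulated (cs ∷ʳ (s , pos D)) a b
      next-triangulated ab∈ with ∈-++⁻ (sides (pos D) rest) (subst (_ ∈_) next-sides ab∈)
      ... | inj₁ old         = Triangulated-++ _ (sides-triangulated (old-side old))
      ... | inj₂ (here refl) = new-side

      next-outside : ∀ {a b v} → (a , b) ∈ cs ∷ʳ (s , pos D) → v ∈ corners (pos D) (rest ∷ʳ D) →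
                     strictlyBetween n a v b ≡ false
      next-outside ab∈ v∈ with ∈-++⁻ cs ab∈ | ∈-++⁻ (corners (pos D) rest) (subst (_ ∈_) next-corners v∈)
      ... | inj₁ old         | inj₁ v∈rest     = corners-outside old (old-corner v∈rest)
      ... | inj₁ old         | inj₂ (here refl) = corners-outside old (here refl)
      ... | inj₂ (here refl) | inj₂ (here refl) =
        between-cw0 {s} {s} {pos D} (trans (cong (cw n s) (sym pos0)) (off-pos (≤-<-trans z≤n base<n)))
      ... | inj₂ (here refl) | inj₁ v∈rest with corners-between D rest rest>0 v∈rest
      ...   | Y′ , D≤Y′ , Y′<n , refl = not-between-base 0<D D≤Y′ (subst (Y′ <_) D+rest≡n Y′<n)

  TCL-∷ʳ : ∀ cs c → TCL n (cs ∷ʳ c) ≡ TCL n cs + chordLength n c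
  TCL-∷ʳ cs c = trans (cong sum (map-++ (chordLength n) cs (c ∷ [])))
                      (trans (sum-++ (map (chordLength n) cs) (chordLength n c ∷ []))
                             (cong (TCL n cs +_) (+-identityʳ _)))

  greedyRun-merges : ∀ {k s cs gs c} → OuterFace s cs gs → Merges k gs c →
                     Σ (List Chord) λ cs′ → greedyRun n k s cs ≡ just cs′ × TCL n cs′ ≡ TCL n cs + c
  greedyRun-merges {cs = cs} face done = cs , refl , sym (+-identityʳ _)
  greedyRun-merges {s = s} {cs} face (merge {c = c} {g₀} {g₁} mid D≤H merges)
    rewrite Step.first-possible mid face D≤H
    with greedyRun-merges (Step.next-face mid face D≤H) merges
  ... | cs′ , run , tcl = cs′ , run , (begin
    TCL n cs′                                                   ≡⟨ tcl ⟩
    TCL n (cs ∷ʳ (s , cwStep n s D)) + c                        ≡⟨ cong (_+ c) (TCL-∷ʳ cs _) ⟩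
    TCL n cs + chordLength n (s , cwStep n s D) + c             ≡⟨ cong (λ l → TCL n cs + l + c)
                                                                        (Step.chord-length mid face D≤H) ⟩
    TCL n cs + D + c                                            ≡⟨ +-assoc (TCL n cs) D c ⟩
    TCL n cs + (D + c)                                          ∎)
    where
    open ≡-Reasoning
    D : ℕ
    D = g₀ + g₁

  unit-sides : ∀ {a b} k v → 1 < n → v < n → (a , b) ∈ sides v (replicate k 1) → cw n a b ≡ 1
  unit-sides (suc k) v 1<n v<n (here refl) = Around.off-pos v v<n 1<n
  unit-sides (suc k) v 1<n v<n (there ab∈) = unit-sides k (cwStep n v 1) 1<n (cwStep<n v 1) ab∈

  initial-face : 1 < n → OuterFace 0 [] (replicate n 1)
  initial-face 1<n = record
    { base<n             = s≤s z≤n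
    ; gaps-positive      = replicate⁺ n (s≤s z≤n)
    ; gaps-sum           = trans (sum-replicate n 1) (*-identityʳ n)
    ; chords<n           = λ ()
    ; sides-triangulated = side ∘ unit-sides n 0 1<n (s≤s z≤n)
    ; corners-outside    = λ ()
    }

proposition1 : (k n : ℕ) → 4 ≤ n → 3 * 2 ^ k ≤ n → n ≤ 3 * 2 ^ (k + 1) →
    Σ (List Chord) (λ cs →
      (greedyChords n ≡ just cs) × (TCL n cs ≡ n * (k + 2) ∸ 3 * 2 ^ (k + 1)))
proposition1 k (suc N) (s≤s 3≤N) lo hi = proj₁ run , proj₁ (proj₂ run) , (begin
  TCL n (proj₁ run)                        ≡⟨ proj₂ (proj₂ run) ⟩
  Q.cost                                   ≡⟨ level-zero-cost queue k+3≡n ⟩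
  (Q.level + 2) * n ∸ 3 * 2 ^ suc Q.level  ≡⟨ level-formula-unique Q.level k Q.lower Q.upper lo
                                                (subst (λ e → n ≤ 3 * 2 ^ e) (+-comm k 1) hi) ⟩
  (k + 2) * n ∸ 3 * 2 ^ suc k              ≡⟨ cong₂ _∸_ (*-comm (k + 2) n)
                                                          (cong (λ e → 3 * 2 ^ e) (+-comm 1 k)) ⟩
  n * (k + 2) ∸ 3 * 2 ^ (k + 1)            ∎)
  where
  open ≡-Reasoning
  open Cycle N
  k+3≡n : N ∸ 2 + 3 ≡ n
  k+3≡n = trans (sym (+-assoc (N ∸ 2) 2 1))
                (trans (cong (_+ 1) (m∸n+n≡m (≤-trans (s≤s (s≤s z≤n)) 3≤N))) (+-comm N 1))
  queue : Merged n (N ∸ 2) 0 (replicate n 1)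
  queue = unit-gaps N (N ∸ 2) k+3≡n
  module Q = Merged queue
  run : Σ (List Chord) λ cs → greedyChords n ≡ just cs × TCL n cs ≡ Q.cost
  run = greedyRun-merges (initial-face (≤-trans (s≤s (s≤s z≤n)) (s≤s 3≤N))) Q.merges
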